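{- Let $\mathcal{U}$ and $\mathcal{V}$ be ultrafilters on $\omega$, let $f:\mathcal{U}\to\mathcal{V}$ be a monotone cofinal map, and suppose there is a cofinal subset $\mathcal{D}\subseteq\mathcal{U}$ such that $f\restriction\mathcal{D}$ is basic. Then there is a continuous, monotone map $\tilde f:\mathcal{P}(\omega)\to\mathcal{P}(\omega)$ such that (1) $\tilde f$ is basic; (2) $\tilde f\restriction\mathcal{D}=f\restriction\mathcal{D}$; and (3) $\tilde f\restriction\mathcal{U}:\mathcal{U}\to\mathcal{V}$ is a cofinal map. Consequently, if $\mathcal{U}$ has the property that for every ultrafilter $\mathcal{V}\le_T\mathcal{U}$ and every monotone cofinal map $f:\mathcal{U}\to\mathcal{V}$ there is a cofinal $\mathcal{D}\subseteq\mathcal{U}$ for which $f\restriction\mathcal{D}$ is basic, then $\mathcal{U}$ has basic Tukey reductions.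
   Context: Ultrafilters are partially ordered by $\supseteq$. For partial orders $E,D$, $f:E\to D$ is cofinal if the image of every cofinal subset of $E$ is cofinal in $D$; $D\le_T E$ iff there is a cofinal map $E\to D$. A map $f$ is monotone if $X\supseteq Y$ implies $f(X)\supseteq f(Y)$. $\mathcal{P}(\omega)$ is identified with $2^\omega$ with the Cantor topology. For $s\in 2^m$, $d(s)=s^{ -1}(\{1\})\subseteq m$; for $s,t\in 2^{<\omega}$, $s\sqsubseteq t$ means $s$ is an initial segment of $t$. For $D\subseteq 2^{<\omega}$, a map $\hat f:D\to 2^{<\omega}$ is level preserving if there is a strictly increasing sequence $(k_m)_{m<\omega}$ with $\{k_m:m<\omega\}=\{|s|:s\in D\}$ and $\hat f(s)\in 2^m$ for every $s\in D\cap 2^{k_m}$; it is initial segment preserving if moreover $s\sqsubseteq s'$ with $s\in D\cap 2^{k_m}$, $s'\in D\cap 2^{k_{m'}}$, $m<m'$, implies $\hat f(s)\sqsubseteq\hat f(s')$; it is monotone if $d(s)\subseteq d(t)$ implies $d(\hat f(s))\subseteq d(\hat f(t))$. A monotone map $f$ on $\mathcal{D}\subseteq\mathcal{P}(\omega)$ is basic if there are a strictly increasing sequence $(k_m)_{m<\omega}$ and, with $D=\bigcup_{m<\omega}\{s\in 2^{k_m}:\exists X\in\mathcal{D}\,(d(s)=X\cap k_m)\}$, a monotone, level and initial segment preserving map $\hat f:D\to 2^{<\omega}$ (with respect to $(k_m)$) such that for every $X\in\mathcal{D}$, $f(X)=\bigcup\{d(\hat f(s)):s\in D\cap 2^{k_m}\text{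 for some }m,\ d(s)=X\cap k_m\}$. An ultrafilter $\mathcal{U}$ on $\omega$ has basic Tukey reductions if whenever $\mathcal{V}$ is an ultrafilter and $f:\mathcal{U}\to\mathcal{V}$ is monotone cofinal, there is a cofinal $\mathcal{X}\subseteq\mathcal{U}$ with $f\restriction\mathcal{X}$ continuous and a continuous monotone $\tilde f:\mathcal{P}(\omega)\to\mathcal{P}(\omega)$ with $\tilde f\restriction\mathcal{X}=f\restriction\mathcal{X}$ and $\tilde f\restriction\mathcal{U}:\mathcal{U}\to\mathcal{V}$ cofinal. -}

module Defs where

open import Data.Nat using (ℕ; zero; suc; _<_; _<ᵇ_)
open import Data.Bool using (Bool; true; false; _∧_; not)
open import Data.Vec using (Vec; []; _∷_)
open import Data.Product using (Σ; _×_; _,_; ∃)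
open import Data.Unit using (⊤)
open import Data.Empty using (⊥)
open import Data.Sum using (_⊎_)
open import Data.Nat using (_≤_)
open import Relation.Nullary using (¬_)
open import Relation.Binary.PropositionalEquality using (_≡_)

-- P(ω) identified with 2^ω = ℕ → Bool

PSet : Set
PSet = ℕ → Bool

_∈_ : ℕ → PSet → Set
i ∈ X = X i ≡ true

infix 4 _∈_ _⊆_ _≐_

_⊆_ : PSet → PSet → Set
X ⊆ Y = ∀ i → i ∈ X → i ∈ Y

_≐_ : PSet → PSet → Set
X ≐ Y = ∀ i → X i ≡ Y i

∅ : PSet
∅ _ = false

full : PSet
full _ = true

_∩_ : PSet → PSet → PSet
(X ∩ Y) i = X i ∧ Y i

compl : PSet → PSet
compl X i = not (X i)

-- X ∩ k  (intersection with the initial segment k = {0,…,k-1})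
_∩<_ : PSet → ℕ → PSet
(X ∩< k) i = X i ∧ (i <ᵇ k)

Family : Set₁
Family = PSet → Set

-- Ultrafilters on ω (not required to be nonprincipal)

record IsUltrafilter (U : Family) : Set where
  field
    full∈    : U full
    ∅∉       : ¬ U ∅
    upward   : ∀ {X Y} → U X → X ⊆ Y → U Y
    ∩-closed : ∀ {X Y} → U X → U Y → U (X ∩ Y)
    ultra    : ∀ X → U X ⊎ U (compl X)

_⊆F_ : Family → Family → Set
𝒜 ⊆F ℬ = ∀ X → 𝒜 X → ℬ X

infix 4 _⊆F_

Everything : Family
Everything _ = ⊤

CofinalIn : Family → Family → Set
CofinalIn 𝒰 𝒳 = ∀ X → 𝒰 X → Σ PSet λ Y → 𝒳 Y × Y ⊆ X

-- A map 𝒰 → 𝒱 is represented by a function f : P(ω) → P(ω) sending 𝒰 into 𝒱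
-- (its values outside 𝒰 are irrelevant to every notion below).
MapsInto : Family → Family → (PSet → PSet) → Set
MapsInto 𝒰 𝒱 f = ∀ X → 𝒰 X → 𝒱 (f X)

CofinalMap : Family → Family → (PSet → PSet) → Set₁
CofinalMap 𝒰 𝒱 f =
  ∀ (𝒳 : Family) → 𝒳 ⊆F 𝒰 → CofinalIn 𝒰 𝒳 →
  ∀ W → 𝒱 W → Σ PSet λ X → 𝒳 X × f X ⊆ W

_≤T_ : Family → Family → Set₁
𝒱 ≤T 𝒰 = Σ (PSet → PSet) λ g → MapsInto 𝒰 𝒱 g × CofinalMap 𝒰 𝒱 g

MonotoneOn : Family → (PSet → PSet) → Set
MonotoneOn 𝒜 f = ∀ X Y → 𝒜 X → 𝒜 Y → Y ⊆ X → f Y ⊆ f X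

ContinuousOn : Family → (PSet → PSet) → Set
ContinuousOn 𝒜 f =
  ∀ X → 𝒜 X → ∀ n → Σ ℕ λ m → ∀ Y → 𝒜 Y →
  (∀ i → i < m → X i ≡ Y i) → ∀ i → i < n → f X i ≡ f Y i

-- Finite binary strings 2^{<ω} as vectors; d(s) as a subset of ω

d : ∀ {n} → Vec Bool n → PSet
d []      i       = false
d (b ∷ s) zero    = b
d (b ∷ s) (suc i) = d s i

_⊑_ : ∀ {n n'} → Vec Bool n → Vec Bool n' → Set
_⊑_ {n} {n'} s t = n ≤ n' × (∀ i → i < n → d s i ≡ d t i)

infix 4 _⊑_

-- s ∈ D at level m, where D = ⋃_m { s ∈ 2^{k_m} : ∃ X ∈ 𝒟, d(s) = X ∩ k_m }
InD : Family → (k : ℕ → ℕ) → (m : ℕ) → Vec Bool (k m) → Set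
InD 𝒟 k m s = Σ PSet λ X → 𝒟 X × d s ≐ (X ∩< k m)

StrictlyIncreasing : (ℕ → ℕ) → Set
StrictlyIncreasing k = ∀ m → k m < k (suc m)

-- The map  f^ : D → 2^{<ω}  is given as a
-- function on all strings of length k_m (only its values on D matter),
-- sending level k_m to 2^m (level preserving).  The condition
-- {k_m} = {|s| : s ∈ D} amounts to 𝒟 being nonempty.
record IsBasic (𝒟 : Family) (f : PSet → PSet) : Set where
  field
    k        : ℕ → ℕ
    k-incr   : StrictlyIncreasing k
    f^       : (m : ℕ) → Vec Bool (k m) → Vec Bool m
    levels   : Σ PSet 𝒟
    f^-mono  : ∀ m m' (s : Vec Bool (k m)) (t : Vec Bool (k m')) →
               InD 𝒟 k m s → InD 𝒟 k m' t →
               d s ⊆ d t → d (f^ m s) ⊆ d (f^ m' t)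
    f^-init  : ∀ m m' (s : Vec Bool (k m)) (t : Vec Bool (k m')) →
               InD 𝒟 k m s → InD 𝒟 k m' t → m < m' →
               s ⊑ t → f^ m s ⊑ f^ m' t
    f-repr⇒  : ∀ X → 𝒟 X → ∀ i → i ∈ f X →
               Σ ℕ λ m → Σ (Vec Bool (k m)) λ s →
                 InD 𝒟 k m s × d s ≐ (X ∩< k m) × i ∈ d (f^ m s)
    f-repr⇐  : ∀ X → 𝒟 X → ∀ i → ∀ m (s : Vec Bool (k m)) →
               InD 𝒟 k m s → d s ≐ (X ∩< k m) → i ∈ d (f^ m s) → i ∈ f X

HasBasicTukeyReductions : Family → Set₁
HasBasicTukeyReductions 𝒰 =
  ∀ (𝒱 : Family) → IsUltrafilter 𝒱 →
  ∀ (f : PSet → PSet) → MapsInto 𝒰 𝒱 f → MonotoneOn 𝒰 f → CofinalMap 𝒰 𝒱 f →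
  Σ Family λ 𝒳 → 𝒳 ⊆F 𝒰 × CofinalIn 𝒰 𝒳 × ContinuousOn 𝒳 f ×
    Σ (PSet → PSet) λ f~ →
      ContinuousOn Everything f~ × MonotoneOn Everything f~ ×
      (∀ X → 𝒳 X → f~ X ≐ f X) ×
      MapsInto 𝒰 𝒱 f~ × CofinalMap 𝒰 𝒱 f~

-- A basic map f↾𝒟 is coded by finite approximations f^ : D → 2^{<ω}, which
-- make sense for every X ⊆ ω: put i into f~(X) iff i ∈ f(Y) for some Y ∈ 𝒟
-- with Y ∩ k_{i+1} ⊆ X.  Because f^ is monotone and initial-segment preserving,
-- whether i ∈ f(Y) is already decided by the level-(i+1) string Y ∩ k_{i+1}, so
-- f~ agrees with f on 𝒟; it is monotone, depends on X ∩ k_{i+1} only (hence is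
-- continuous and basic with the same sequence k).  Monotonicity and agreement on
-- the cofinal family 𝒟 then transfer "maps 𝒰 into 𝒱" and cofinality from f to f~.
module Submission where

open import Defs
open import Level using (0ℓ)
open import Axiom.ExcludedMiddle using (ExcludedMiddle)
open import Data.Bool using (Bool; true)
open import Data.Bool.Properties using (T-≡; T-∧; ⇔→≡; ∧-zeroʳ)
open import Data.Nat using (ℕ; zero; suc; _<_; _≤_; _≤′_; z≤n; s≤s; ≤′-refl; ≤′-step)
open import Data.Nat.Properties
  using (≤-refl; ≤-trans; <-trans; <-≤-trans; <⇒≤; n<1+n; ≤⇒≤′; <ᵇ⇒<; <⇒<ᵇ; m≤n⇒m<n∨m≡n)
open import Data.Product using (Σ; _×_; _,_; proj₁; proj₂)
open import Data.Sum using (inj₁; inj₂)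
open import Data.Unit using (tt)
open import Data.Vec using (Vec; []; _∷_)
open import Function.Bundles using (Equivalence; mk⇔)
open import Relation.Nullary using (Dec; yes; does)
open import Relation.Nullary.Decidable using (dec-true; does-⇔)
open import Relation.Binary.PropositionalEquality using (_≡_; refl; sym; trans)

AgreeBelow : ℕ → PSet → PSet → Set
AgreeBelow n X Y = ∀ i → i < n → X i ≡ Y i

∈∩<⇒∈ : ∀ X n {i} → i ∈ X ∩< n → i ∈ X
∈∩<⇒∈ _ _ h = Equivalence.to T-≡ (proj₁ (Equivalence.to T-∧ (Equivalence.from T-≡ h)))

∈∩<⇒< : ∀ X n {i} → i ∈ X ∩< n → i < n
∈∩<⇒< _ _ {i} h = <ᵇ⇒< i _ (proj₂ (Equivalence.to T-∧ (Equivalence.from T-≡ h)))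

∩<-below : ∀ X {n i} → i < n → (X ∩< n) i ≡ X i
∩<-below X {n} i<n = ⇔→≡ (mk⇔ (∈∩<⇒∈ X n) λ h →
  Equivalence.to T-≡ (Equivalence.from T-∧ (Equivalence.from T-≡ h , <⇒<ᵇ i<n)))

∈-∩< : ∀ X n {i} → i ∈ X → i < n → i ∈ X ∩< n
∈-∩< X _ i∈X i<n = trans (∩<-below X i<n) i∈X

prefix : (n : ℕ) → PSet → Vec Bool n
prefix zero    X = []
prefix (suc n) X = X 0 ∷ prefix n (λ i → X (suc i))

d-prefix : ∀ n X → d (prefix n X) ≐ X ∩< n
d-prefix zero    X i       = sym (∧-zeroʳ (X i))
d-prefix (suc n) X zero    = sym (∩<-below X {suc n} (s≤s z≤n))
d-prefix (suc n) X (suc i) = d-prefix n (λ j → X (suc j)) i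

prefix-below : ∀ n X {i} → i < n → d (prefix n X) i ≡ X i
prefix-below n X i<n = trans (d-prefix n X _) (∩<-below X i<n)

d-bounded : ∀ {n} (s : Vec Bool n) {i} → i ∈ d s → i < n
d-bounded []      ()
d-bounded (b ∷ s) {zero}  _ = s≤s z≤n
d-bounded (b ∷ s) {suc i} h = s≤s (d-bounded s h)

prefix-⊑ : ∀ {n n'} X → n ≤ n' → prefix n X ⊑ prefix n' X
prefix-⊑ X n≤n' = n≤n' , λ i i<n →
  trans (prefix-below _ X i<n) (sym (prefix-below _ X (<-≤-trans i<n n≤n')))

prefix-⊆ : ∀ n n' X Y → X ∩< n ⊆ Y ∩< n' → d (prefix n X) ⊆ d (prefix n' Y)
prefix-⊆ n n' X Y sub i h =
  trans (d-prefix n' Y i) (sub i (trans (sym (d-prefix n X i)) h))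

strictlyIncreasing⇒mono : ∀ {k} → StrictlyIncreasing k → ∀ {a b} → a ≤ b → k a ≤ k b
strictlyIncreasing⇒mono {k} k-incr a≤b = go (≤⇒≤′ a≤b)
  where
  go : ∀ {a b} → a ≤′ b → k a ≤ k b
  go ≤′-refl      = ≤-refl
  go (≤′-step a≤b) = ≤-trans (go a≤b) (<⇒≤ (k-incr _))

does-true : ∀ {A : Set} (a? : Dec A) → does a? ≡ true → A
does-true (yes a) _ = a

module _ {𝒰 𝒱 𝒟 : Family} {f g : PSet → PSet}
         (𝒟⊆𝒰 : 𝒟 ⊆F 𝒰) (𝒟-cofinal : CofinalIn 𝒰 𝒟)
         (g-mono : MonotoneOn Everything g) (g≐f : ∀ X → 𝒟 X → g X ≐ f X) where

  agreement⇒mapsInto : IsUltrafilter 𝒱 → MapsInto 𝒰 𝒱 f → MapsInto 𝒰 𝒱 g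
  agreement⇒mapsInto U𝒱 f-maps X X∈𝒰 with 𝒟-cofinal X X∈𝒰
  ... | Y , Y∈𝒟 , Y⊆X = IsUltrafilter.upward U𝒱 (f-maps Y (𝒟⊆𝒰 Y Y∈𝒟))
          λ i h → g-mono X Y tt tt Y⊆X i (trans (g≐f Y Y∈𝒟 i) h)

  -- Apply cofinality of f to the members of 𝒟 lying above some member of 𝒳,
  -- then descend to that member using monotonicity of g.
  agreement⇒cofinalMap : CofinalMap 𝒰 𝒱 f → CofinalMap 𝒰 𝒱 g
  agreement⇒cofinalMap f-cofinal 𝒳 _ 𝒳-cofinal W W∈𝒱
    with f-cofinal 𝒴 𝒴⊆𝒰 𝒴-cofinal W W∈𝒱
    where
    𝒴 : Family
    𝒴 Z = 𝒟 Z × Σ PSet λ X → 𝒳 X × X ⊆ Z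
    𝒴⊆𝒰 : 𝒴 ⊆F 𝒰
    𝒴⊆𝒰 Z (Z∈𝒟 , _) = 𝒟⊆𝒰 Z Z∈𝒟
    𝒴-cofinal : CofinalIn 𝒰 𝒴
    𝒴-cofinal A A∈𝒰 with 𝒟-cofinal A A∈𝒰
    ... | Z , Z∈𝒟 , Z⊆A with 𝒳-cofinal Z (𝒟⊆𝒰 Z Z∈𝒟)
    ... | X , X∈𝒳 , X⊆Z = Z , (Z∈𝒟 , X , X∈𝒳 , X⊆Z) , Z⊆A
  ... | Z , (Z∈𝒟 , X , X∈𝒳 , X⊆Z) , fZ⊆W =
    X , X∈𝒳 , λ i h → fZ⊆W i (trans (sym (g≐f Z Z∈𝒟 i)) (g-mono Z X tt tt X⊆Z i h))

continuous-agreement : ∀ {𝒟 f g} → ContinuousOn Everything g →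
                       (∀ X → 𝒟 X → g X ≐ f X) → ContinuousOn 𝒟 f
continuous-agreement g-cont g≐f X X∈𝒟 n with g-cont X tt n
... | m , c = m , λ Y Y∈𝒟 ag i i<n →
  trans (sym (g≐f X X∈𝒟 i)) (trans (c Y tt ag i i<n) (g≐f Y Y∈𝒟 i))

module Basic {𝒟 : Family} {f : PSet → PSet} (B : IsBasic 𝒟 f) where
  open IsBasic B

  k-mono : ∀ {a b} → a ≤ b → k a ≤ k b
  k-mono = strictlyIncreasing⇒mono k-incr

  _↾_ : PSet → (m : ℕ) → Vec Bool (k m)
  X ↾ m = prefix (k m) X

  ↾-InD : ∀ {X} → 𝒟 X → ∀ m → InD 𝒟 k m (X ↾ m)
  ↾-InD {X} X∈𝒟 m = X , X∈𝒟 , d-prefix (k m) X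

  f^-prefix-coherent : ∀ {X} → 𝒟 X → ∀ {i m} → suc i ≤ m →
    d (f^ m (X ↾ m)) i ≡ d (f^ (suc i) (X ↾ suc i)) i
  f^-prefix-coherent {X} X∈𝒟 {i} {m} i<m with m≤n⇒m<n∨m≡n i<m
  ... | inj₂ refl = refl
  ... | inj₁ lt   =
    sym (proj₂ (f^-init (suc i) m (X ↾ suc i) (X ↾ m) (↾-InD X∈𝒟 _) (↾-InD X∈𝒟 _)
                        lt (prefix-⊑ X (k-mono (<⇒≤ lt)))) i (n<1+n i))

  f-at-level : ∀ {X} → 𝒟 X → ∀ i → f X i ≡ d (f^ (suc i) (X ↾ suc i)) i
  f-at-level {X} X∈𝒟 i = ⇔→≡ (mk⇔ to from)
    where
    to : i ∈ f X → i ∈ d (f^ (suc i) (X ↾ suc i))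
    to h with f-repr⇒ X X∈𝒟 i h
    ... | m , s , s∈D , s≐ , i∈ =
      trans (sym (f^-prefix-coherent X∈𝒟 (d-bounded (f^ m (X ↾ m)) i∈′))) i∈′
      where
      i∈′ : i ∈ d (f^ m (X ↾ m))
      i∈′ = f^-mono m m s (X ↾ m) s∈D (↾-InD X∈𝒟 m)
              (λ j h → trans (d-prefix (k m) X j) (trans (sym (s≐ j)) h)) i i∈
    from : i ∈ d (f^ (suc i) (X ↾ suc i)) → i ∈ f X
    from = f-repr⇐ X X∈𝒟 i (suc i) (X ↾ suc i) (↾-InD X∈𝒟 _) (d-prefix (k (suc i)) X)

  level-bound : ∀ {Y i m} → 𝒟 Y → i ∈ f Y →
                (∀ j → j ∈ Y ∩< k (suc i) → j < k m) → i < m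
  level-bound {Y} {i} {m} Y∈𝒟 i∈fY below =
    d-bounded (f^ m (Y ↾ m))
      (f^-mono (suc i) m (Y ↾ suc i) (Y ↾ m) (↾-InD Y∈𝒟 _) (↾-InD Y∈𝒟 _)
        (prefix-⊆ (k (suc i)) (k m) Y Y λ j h →
           ∈-∩< Y (k m) (∈∩<⇒∈ Y (k (suc i)) h) (below j h)) i
        (trans (sym (f-at-level Y∈𝒟 i)) i∈fY))

module Extension (lem : ExcludedMiddle 0ℓ) {𝒟 : Family} {f : PSet → PSet}
                 (B : IsBasic 𝒟 f) where
  open IsBasic B
  open Basic B

  Witness : ℕ → PSet → Set
  Witness i X = Σ PSet λ Y → 𝒟 Y × Y ∩< k (suc i) ⊆ X × i ∈ f Y

  f~ : PSet → PSet
  f~ X i = does (lem {Witness i X})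

  f~⇒witness : ∀ {X i} → i ∈ f~ X → Witness i X
  f~⇒witness = does-true lem

  witness⇒f~ : ∀ {X i} → Witness i X → i ∈ f~ X
  witness⇒f~ = dec-true lem

  witness-local : ∀ {i X X'} → AgreeBelow (k (suc i)) X X' → Witness i X → Witness i X'
  witness-local ag (Y , Y∈𝒟 , sub , i∈fY) =
    Y , Y∈𝒟 , (λ j h → trans (sym (ag j (∈∩<⇒< Y _ h))) (sub j h)) , i∈fY

  f~-local : ∀ {i X X'} → AgreeBelow (k (suc i)) X X' → f~ X i ≡ f~ X' i
  f~-local ag = does-⇔ (mk⇔ (witness-local ag) (witness-local λ j j< → sym (ag j j<))) lem lem

  f~-local-≤ : ∀ {i m X X'} → i < m → AgreeBelow (k m) X X' → f~ X i ≡ f~ X' i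
  f~-local-≤ i<m ag = f~-local λ j j< → ag j (<-≤-trans j< (k-mono i<m))

  f~-monotone : MonotoneOn Everything f~
  f~-monotone X Y _ _ Y⊆X i h with f~⇒witness h
  ... | Z , Z∈𝒟 , sub , i∈fZ = witness⇒f~ (Z , Z∈𝒟 , (λ j h → Y⊆X j (sub j h)) , i∈fZ)

  f~-continuous : ContinuousOn Everything f~
  f~-continuous X _ n = k n , λ Y _ ag i i<n → f~-local-≤ i<n ag

  -- A witness Y transfers i ∈ f Y to i ∈ f X through the level-(i+1) prefixes.
  f~-agrees : ∀ X → 𝒟 X → f~ X ≐ f X
  f~-agrees X X∈𝒟 i =
    ⇔→≡ (mk⇔ to λ h → witness⇒f~ (X , X∈𝒟 , (λ j → ∈∩<⇒∈ X (k (suc i))) , h))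
    where
    to : i ∈ f~ X → i ∈ f X
    to h with f~⇒witness h
    ... | Y , Y∈𝒟 , sub , i∈fY =
      trans (f-at-level X∈𝒟 i)
        (f^-mono (suc i) (suc i) (Y ↾ suc i) (X ↾ suc i) (↾-InD Y∈𝒟 _) (↾-InD X∈𝒟 _)
          (prefix-⊆ (k (suc i)) (k (suc i)) Y X λ j h →
             ∈-∩< X (k (suc i)) (sub j h) (∈∩<⇒< Y (k (suc i)) h)) i
          (trans (sym (f-at-level Y∈𝒟 i)) i∈fY))

  f~^ : (m : ℕ) → Vec Bool (k m) → Vec Bool m
  f~^ m t = prefix m (f~ (d t))

  ∈f~^⇒ : ∀ {m} t {i} → i ∈ d (f~^ m t) → i ∈ f~ (d t) × i < m
  ∈f~^⇒ {m} t {i} h = ∈∩<⇒∈ (f~ (d t)) m i∈∩ , ∈∩<⇒< (f~ (d t)) m i∈∩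
    where
    i∈∩ : i ∈ f~ (d t) ∩< m
    i∈∩ = trans (sym (d-prefix m (f~ (d t)) i)) h

  f~^-mono : ∀ m m' (s : Vec Bool (k m)) (t : Vec Bool (k m')) →
             d s ⊆ d t → d (f~^ m s) ⊆ d (f~^ m' t)
  f~^-mono m m' s t s⊆t i h
    with f~⇒witness (f~-monotone (d t) (d s) tt tt s⊆t i (proj₁ (∈f~^⇒ s h)))
  ... | w@(Y , Y∈𝒟 , sub , i∈fY) =
    trans (d-prefix m' _ i)
      (∈-∩< (f~ (d t)) m' (witness⇒f~ w) (level-bound Y∈𝒟 i∈fY λ j h → d-bounded t (sub j h)))

  f~-basic : IsBasic Everything f~
  f~-basic = record
    { k       = k
    ; k-incr  = k-incr
    ; f^      = f~^
    ; levels  = full , tt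
    ; f^-mono = λ m m' s t _ _ → f~^-mono m m' s t
    ; f^-init = λ m m' s t _ _ m<m' (_ , s~t) →
        <⇒≤ m<m' , λ i i<m → trans (prefix-below m (f~ (d s)) i<m)
          (trans (f~-local-≤ i<m s~t) (sym (prefix-below m' (f~ (d t)) (<-trans i<m m<m'))))
    ; f-repr⇒ = λ X _ i h →
        suc i , X ↾ suc i , (X , tt , d-prefix (k (suc i)) X) , d-prefix (k (suc i)) X ,
        trans (prefix-below (suc i) (f~ (d (X ↾ suc i))) (n<1+n i))
          (trans (f~-local λ j j< → prefix-below (k (suc i)) X j<) h)
    ; f-repr⇐ = λ X _ i m s _ s≐ h →
        let (i∈ , i<m) = ∈f~^⇒ s h
        in trans (sym (f~-local-≤ i<m λ j j< → trans (s≐ j) (∩<-below X j<))) i∈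
    }

BasicCofinalExtension : Family → Family → Family → (PSet → PSet) → Set₁
BasicCofinalExtension 𝒰 𝒱 𝒟 f =
  Σ (PSet → PSet) λ f~ →
    ContinuousOn Everything f~ × MonotoneOn Everything f~ ×
    IsBasic Everything f~ ×
    (∀ X → 𝒟 X → f~ X ≐ f X) ×
    MapsInto 𝒰 𝒱 f~ × CofinalMap 𝒰 𝒱 f~

basic-extension : ExcludedMiddle 0ℓ → ∀ {𝒰 𝒱 𝒟 f} → IsUltrafilter 𝒱 →
  MapsInto 𝒰 𝒱 f → CofinalMap 𝒰 𝒱 f → 𝒟 ⊆F 𝒰 → CofinalIn 𝒰 𝒟 → IsBasic 𝒟 f →
  BasicCofinalExtension 𝒰 𝒱 𝒟 f
basic-extension lem U𝒱 f-maps f-cofinal 𝒟⊆𝒰 𝒟-cofinal B =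
  f~ , f~-continuous , f~-monotone , f~-basic , f~-agrees ,
  agreement⇒mapsInto 𝒟⊆𝒰 𝒟-cofinal f~-monotone f~-agrees U𝒱 f-maps ,
  agreement⇒cofinalMap 𝒟⊆𝒰 𝒟-cofinal f~-monotone f~-agrees f-cofinal
  where open Extension lem B

BasicOnCofinal : Family → Set₁
BasicOnCofinal 𝒰 =
  ∀ (𝒱 : Family) → IsUltrafilter 𝒱 → 𝒱 ≤T 𝒰 →
  ∀ (f : PSet → PSet) → MapsInto 𝒰 𝒱 f → MonotoneOn 𝒰 f → CofinalMap 𝒰 𝒱 f →
  Σ Family λ 𝒟 → 𝒟 ⊆F 𝒰 × CofinalIn 𝒰 𝒟 × IsBasic 𝒟 f

BasicTukeyReduction : Family → Family → (PSet → PSet) → Set₁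
BasicTukeyReduction 𝒰 𝒱 f =
  Σ Family λ 𝒳 → 𝒳 ⊆F 𝒰 × CofinalIn 𝒰 𝒳 × ContinuousOn 𝒳 f ×
    Σ (PSet → PSet) λ f~ →
      ContinuousOn Everything f~ × MonotoneOn Everything f~ ×
      (∀ X → 𝒳 X → f~ X ≐ f X) ×
      MapsInto 𝒰 𝒱 f~ × CofinalMap 𝒰 𝒱 f~

extension⇒reduction : ∀ {𝒰 𝒱 𝒟 f} → 𝒟 ⊆F 𝒰 → CofinalIn 𝒰 𝒟 →
  BasicCofinalExtension 𝒰 𝒱 𝒟 f → BasicTukeyReduction 𝒰 𝒱 f
extension⇒reduction {𝒟 = 𝒟} 𝒟⊆𝒰 𝒟-cofinal
                    (f~ , f~-cont , f~-mono , _ , f~≐f , f~-maps , f~-cofinal) =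
  𝒟 , 𝒟⊆𝒰 , 𝒟-cofinal , continuous-agreement f~-cont f~≐f ,
  f~ , f~-cont , f~-mono , f~≐f , f~-maps , f~-cofinal

basic-on-cofinal⇒basicTukeyReductions : ExcludedMiddle 0ℓ → ∀ {𝒰} →
  BasicOnCofinal 𝒰 → HasBasicTukeyReductions 𝒰
basic-on-cofinal⇒basicTukeyReductions lem basic-on-cofinal 𝒱 U𝒱 f f-maps f-mono f-cofinal
  with basic-on-cofinal 𝒱 U𝒱 (f , f-maps , f-cofinal) f f-maps f-mono f-cofinal
... | 𝒟 , 𝒟⊆𝒰 , 𝒟-cofinal , B =
  extension⇒reduction 𝒟⊆𝒰 𝒟-cofinal (basic-extension lem U𝒱 f-maps f-cofinal 𝒟⊆𝒰 𝒟-cofinal B)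

theorem7 : ExcludedMiddle 0ℓ →
    (∀ (𝒰 𝒱 : Family) → IsUltrafilter 𝒰 → IsUltrafilter 𝒱 →
     ∀ (f : PSet → PSet) → MapsInto 𝒰 𝒱 f → MonotoneOn 𝒰 f → CofinalMap 𝒰 𝒱 f →
     ∀ (𝒟 : Family) → 𝒟 ⊆F 𝒰 → CofinalIn 𝒰 𝒟 → IsBasic 𝒟 f →
     Σ (PSet → PSet) λ f~ →
       ContinuousOn Everything f~ × MonotoneOn Everything f~ ×
       IsBasic Everything f~ ×
       (∀ X → 𝒟 X → f~ X ≐ f X) ×
       MapsInto 𝒰 𝒱 f~ × CofinalMap 𝒰 𝒱 f~)
    ×
    (∀ (𝒰 : Family) → IsUltrafilter 𝒰 →
     (∀ (𝒱 : Family) → IsUltrafilter 𝒱 → 𝒱 ≤T 𝒰 →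
      ∀ (f : PSet → PSet) → MapsInto 𝒰 𝒱 f → MonotoneOn 𝒰 f → CofinalMap 𝒰 𝒱 f →
      Σ Family λ 𝒟 → 𝒟 ⊆F 𝒰 × CofinalIn 𝒰 𝒟 × IsBasic 𝒟 f) →
     HasBasicTukeyReductions 𝒰)
theorem7 lem =
  (λ _ _ _ U𝒱 _ f-maps _ f-cofinal _ → basic-extension lem U𝒱 f-maps f-cofinal) ,
  (λ _ _ → basic-on-cofinal⇒basicTukeyReductions lem)
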